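{- Let $G=(\Gamma,s)$ be a graph, and let $v\in\tilde V$ be a non-sink vertex such that $\mathrm{mult}(ws)=\mathrm{mult}(wv)$ for all $w\in V\setminus\{s,v\}$. Let $p$ be a prime $G$-parking function such that $v\in V_M(p)$, where $V_M(p):=\{u\in\tilde V:p(u)\le\mathrm{mult}(us)\}$. Then the restriction of $p$ to $\tilde V\setminus\{v\}$ is a $(G\setminus\{v\})$-parking function.
   Context: A graph $G=(\Gamma,s)$ is a finite, undirected, connected multigraph (multiple edges allowed, no loops) with vertex set $V$ and distinguished sink $s$; $\tilde V=V\setminus\{s\}$. $G\setminus\{v\}$ is the graph obtained by deleting $v$ and its incident edges, with sink $s$. $\mathrm{mult}(vw)$ is the number of edges between $v,w$; $\deg^A(v)=\sum_{w\in A}\mathrm{mult}(vw)$. $\mathbb N=\{1,2,\dots\}$. For a graph $H$ (not necessarily connected) with sink $s$, vertex set $V_H$, non-sink vertex set $\tilde V_H$, an $H$-parking function is $p:\tilde V_H\to\mathbb N$ such that every non-empty $S\subseteq\tilde V_H$ contains $u$ with $p(u)\le\deg_H^{V_H\setminus S}(u)$. For $A\subseteq\tilde V$, $G^A$ is the induced subgraph on $A\cup\{s\}$ with sink $s$. A $G$-parking function $p$ is decomposable w.r.t. an ordered partition $(A,B)$ of $\tilde V$ ($A,B\ne\emptyset$) if $p|_A$ is a $G^A$-parking function and $u\mapsto p(u)-\deg^A(u)$ on $B$ is a $G^B$-parking function; $p$ is prime if decomposable w.r.t. no such partition. -}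

module Defs where

open import Data.Nat using (ℕ; zero; suc; _+_; _∸_; _≤_)
open import Data.Fin using (Fin)
open import Data.Fin.Subset using (Subset; _∈_; _∉_; _⊆_; _∪_; _─_; ⁅_⁆; ∁; ⊤; Nonempty)
open import Data.Vec using (lookup; tabulate; sum)
open import Data.Bool using (if_then_else_)
open import Data.Product using (Σ; _×_; ∃)
open import Relation.Binary.PropositionalEquality using (_≡_; _≢_)
open import Relation.Nullary using (¬_)

data Reachable {m : ℕ} (mult : Fin m → Fin m → ℕ) : Fin m → Fin m → Set where
  here : ∀ {u} → Reachable mult u u
  step : ∀ {u w x} → 1 ≤ mult u w → Reachable mult w x → Reachable mult u x

record Graph : Set where
  field
    m         : ℕ
    mult      : Fin m → Fin m → ℕ
    symmetric : ∀ u w → mult u w ≡ mult w u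
    loopless  : ∀ u → mult u u ≡ 0
    connected : ∀ u w → Reachable mult u w
    sink      : Fin m

module _ (G : Graph) where
  open Graph G

  deg : Subset m → Fin m → ℕ
  deg A u = sum (tabulate λ w → if lookup A w then mult u w else 0)

  Ṽ : Subset m
  Ṽ = ∁ ⁅ sink ⁆

  -- H-parking function, where H is the subgraph of G induced on a vertex
  -- set W (with s ∈ W) and sink s.  p is a total function; only its values
  -- on W \ {s} matter.  Values in ℕ = {1,2,...} is the first component.
  IsParking : (W : Subset m) → (Fin m → ℕ) → Set
  IsParking W p =
    (∀ u → u ∈ W → u ≢ sink → 1 ≤ p u) ×
    (∀ (S : Subset m) → S ⊆ W → sink ∉ S → Nonempty S →
       ∃ λ u → u ∈ S × p u ≤ deg (W ─ S) u)

  IsGParking : (Fin m → ℕ) → Set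
  IsGParking p = IsParking ⊤ p

  -- The shifted function
  -- u ↦ p(u) - deg^A(u) uses truncated subtraction: if the true value is ≤ 0
  -- it becomes 0, which (correctly) violates the requirement 1 ≤ value.
  Decomposable : (Fin m → ℕ) → Subset m → Set
  Decomposable p A =
    IsParking (A ∪ ⁅ sink ⁆) p ×
    IsParking ((Ṽ ─ A) ∪ ⁅ sink ⁆) (λ u → p u ∸ deg A u)

  IsPrime : (Fin m → ℕ) → Set
  IsPrime p =
    IsGParking p ×
    (∀ (A : Subset m) → A ⊆ Ṽ → Nonempty A → Nonempty (Ṽ ─ A) →
       ¬ Decomposable p A)

  DeleteVertex : Fin m → Subset m
  DeleteVertex v = ∁ ⁅ v ⁆

-- Let S ⊆ Ṽ ∖ {v} be a set on which p fails the parking condition for G ∖ {v}, chosen maximal.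
-- Since v and s have the same neighbours off {s, v}, swapping s for v does not change the degree
-- of a vertex of S into the rest, so with A = Ṽ ∖ S the shifted function p − deg^A is still
-- positive on S, and p is decomposable w.r.t. (A, S). The half on A holds because a failing set
-- T ⊆ A would make S ∪ T fail either for G itself (if v ∈ T) or for G ∖ {v} (if v ∉ T),
-- contradicting that p is a G-parking function or the maximality of S. This contradicts primality.
module Submission where

open import Defs
open import Data.Nat using (ℕ; zero; suc; _+_; _∸_; _≤_; _<_; z≤n; _≤?_)
open import Data.Nat.Properties
  using (+-mono-≤; ≤-refl; ≤-<-trans; <⇒≱; ≰⇒>; +-identityʳ; +-cancelʳ-≡;
         m<n⇒0<n∸m; m≤n+o⇒m∸n≤o; +-commutativeSemigroup)
open import Algebra.Properties.CommutativeSemigroup +-commutativeSemigroup using (interchange)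
open import Data.Fin using (Fin)
open import Data.Fin.Properties using (any?; _≟_)
open import Data.Fin.Subset
open import Data.Fin.Subset.Properties
open import Data.Fin.Subset.Induction using (⊃-wellFounded)
open import Induction.WellFounded using (module All)
open import Data.Vec using (_∷_; here; there; lookup; tabulate; sum)
open import Data.Vec.Properties using ([]=⇒lookup; lookup⇒[]=)
open import Data.Bool using (true; false; if_then_else_)
open import Data.Product using (_×_; ∃; _,_; proj₁; proj₂)
open import Data.Sum using (_⊎_; inj₁; inj₂; [_,_])
open import Data.Empty using (⊥-elim)
open import Function using (_∘_)
open import Level using (0ℓ)
open import Relation.Binary.PropositionalEquality
  using (_≡_; _≢_; refl; sym; trans; cong; cong₂; subst; module ≡-Reasoning)
open import Relation.Nullary using (¬_; yes; no)
open import Relation.Nullary.Decidable using (_×-dec_)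

private
  variable
    n : ℕ
    x y : Fin n
    p q r X Y Z : Subset n
    f g h : Fin n → ℕ

x∈p─q⇒x∉q : x ∈ p ─ q → x ∉ q
x∈p─q⇒x∉q {p = _ ∷ p} {inside  ∷ q} ()        here
x∈p─q⇒x∉q {p = _ ∷ p} {outside ∷ q} here      ()
x∈p─q⇒x∉q {p = _ ∷ p} {_       ∷ q} (there i) (there j) = x∈p─q⇒x∉q i j

x∈p─[p─q]⇒x∈q : x ∈ p ─ (p ─ q) → x ∈ q
x∈p─[p─q]⇒x∈q {x = x} {p} {q} x∈ with x ∈? q
... | yes x∈q = x∈q
... | no  x∉q = ⊥-elim (x∈p─q⇒x∉q x∈ (x∈p∧x∉q⇒x∈p─q (p─q⊆p p _ x∈) x∉q))

x∈p─[q∪r]⁻ : x ∈ p ─ (q ∪ r) → x ∈ p × x ∉ q × x ∉ r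
x∈p─[q∪r]⁻ {p = p} x∈ = p─q⊆p p _ x∈ , x∉q∪r ∘ x∈p∪q⁺ ∘ inj₁ , x∉q∪r ∘ x∈p∪q⁺ ∘ inj₂
  where x∉q∪r = x∈p─q⇒x∉q x∈

x∉p∧x∉q⇒x∉p∪q : x ∉ p → x ∉ q → x ∉ p ∪ q
x∉p∧x∉q⇒x∉p∪q {p = p} {q} x∉p x∉q = [ x∉p , x∉q ] ∘ x∈p∪q⁻ p q

x≢y⇒x∈∁⁅y⁆ : x ≢ y → x ∈ ∁ ⁅ y ⁆
x≢y⇒x∈∁⁅y⁆ = x∉p⇒x∈∁p ∘ x≢y⇒x∉⁅y⁆

x∈∁⁅y⁆⇒x≢y : x ∈ ∁ ⁅ y ⁆ → x ≢ y
x∈∁⁅y⁆⇒x≢y = x∉⁅y⁆⇒x≢y ∘ x∈∁p⇒x∉p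

sum-tabulate-mono : (∀ i → f i ≤ g i) → sum (tabulate f) ≤ sum (tabulate g)
sum-tabulate-mono {zero}  _   = z≤n
sum-tabulate-mono {suc n} f≤g = +-mono-≤ (f≤g Fin.zero) (sum-tabulate-mono (f≤g ∘ Fin.suc))

sum-tabulate-+ : (∀ i → f i ≡ g i + h i) → sum (tabulate f) ≡ sum (tabulate g) + sum (tabulate h)
sum-tabulate-+ {zero}                  _      = refl
sum-tabulate-+ {suc n} {g = g} {h = h} f≗g+h = trans
  (cong₂ _+_ (f≗g+h Fin.zero) (sum-tabulate-+ (f≗g+h ∘ Fin.suc)))
  (interchange (g Fin.zero) (h Fin.zero) _ _)

-- deg G X u is definitionally sumOver X (mult u).
sumOver : Subset n → (Fin n → ℕ) → ℕ
sumOver X f = sum (tabulate λ w → if lookup X w then f w else 0)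

sumOver-term-∈ : (f : Fin n → ℕ) → x ∈ X → (if lookup X x then f x else 0) ≡ f x
sumOver-term-∈ f x∈X rewrite []=⇒lookup x∈X = refl

sumOver-term-∉ : (f : Fin n → ℕ) → x ∉ X → (if lookup X x then f x else 0) ≡ 0
sumOver-term-∉ {x = x} {X = X} f x∉X with lookup X x in eq
... | true  = ⊥-elim (x∉X (lookup⇒[]= x X eq))
... | false = refl

sumOver-mono : X ⊆ Y → sumOver X f ≤ sumOver Y f
sumOver-mono {X = X} {Y} {f = f} X⊆Y = sum-tabulate-mono termwise
  where
  termwise : ∀ w → (if lookup X w then f w else 0) ≤ (if lookup Y w then f w else 0)
  termwise w with w ∈? X
  ... | yes w∈X rewrite sumOver-term-∈ f w∈X | sumOver-term-∈ f (X⊆Y w∈X) = ≤-refl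
  ... | no  w∉X rewrite sumOver-term-∉ f w∉X = z≤n

sumOver-split : (∀ {w} → w ∈ Z → w ∈ X ⊎ w ∈ Y) → X ⊆ Z → Y ⊆ Z → (∀ {w} → w ∈ X → w ∉ Y) →
                sumOver Z f ≡ sumOver X f + sumOver Y f
sumOver-split {Z = Z} {X} {Y} {f = f} Z⊆X⊎Y X⊆Z Y⊆Z disjoint = sum-tabulate-+ termwise
  where
  termwise : ∀ w → (if lookup Z w then f w else 0) ≡
                   (if lookup X w then f w else 0) + (if lookup Y w then f w else 0)
  termwise w with w ∈? Z
  ... | no w∉Z
    rewrite sumOver-term-∉ f w∉Z | sumOver-term-∉ f (w∉Z ∘ X⊆Z) | sumOver-term-∉ f (w∉Z ∘ Y⊆Z) = refl
  ... | yes w∈Z with Z⊆X⊎Y w∈Z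
  ...   | inj₁ w∈X
    rewrite sumOver-term-∈ f w∈Z | sumOver-term-∈ f w∈X | sumOver-term-∉ f (disjoint w∈X) =
      sym (+-identityʳ (f w))
  ...   | inj₂ w∈Y
    rewrite sumOver-term-∈ f w∈Z | sumOver-term-∈ f w∈Y | sumOver-term-∉ f (λ w∈X → disjoint w∈X w∈Y) =
      refl

sumOver-⊥ : (f : Fin n → ℕ) → sumOver ⊥ f ≡ 0
sumOver-⊥ {zero}  f = refl
sumOver-⊥ {suc n} f = sumOver-⊥ (f ∘ Fin.suc)

sumOver-⁅⁆ : (a : Fin n) (f : Fin n → ℕ) → sumOver ⁅ a ⁆ f ≡ f a
sumOver-⁅⁆ Fin.zero    f = trans (cong (f Fin.zero +_) (sumOver-⊥ (f ∘ Fin.suc))) (+-identityʳ _)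
sumOver-⁅⁆ (Fin.suc a) f = sumOver-⁅⁆ a (f ∘ Fin.suc)

sumOver-∁ : ∀ {S : Subset n} {a} (f : Fin n → ℕ) → a ∉ S →
            sumOver (∁ S) f ≡ sumOver (∁ ⁅ a ⁆ ─ S) f + f a
sumOver-∁ {S = S} {a} f a∉S = trans (sumOver-split cover (x∉p⇒x∈∁p ∘ x∈p─q⇒x∉q) a∈∁S disjoint)
                                    (cong (sumOver (∁ ⁅ a ⁆ ─ S) f +_) (sumOver-⁅⁆ a f))
  where
  cover : ∀ {w} → w ∈ ∁ S → w ∈ ∁ ⁅ a ⁆ ─ S ⊎ w ∈ ⁅ a ⁆
  cover {w} w∈∁S with w ≟ a
  ... | yes refl = inj₂ (x∈⁅x⁆ a)
  ... | no  w≢a  = inj₁ (x∈p∧x∉q⇒x∈p─q (x≢y⇒x∈∁⁅y⁆ w≢a) (x∈∁p⇒x∉p w∈∁S))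
  a∈∁S : ∀ {w} → w ∈ ⁅ a ⁆ → w ∈ ∁ S
  a∈∁S w∈⁅a⁆ rewrite x∈⁅y⁆⇒x≡y a w∈⁅a⁆ = x∉p⇒x∈∁p a∉S
  disjoint : ∀ {w} → w ∈ ∁ ⁅ a ⁆ ─ S → w ∉ ⁅ a ⁆
  disjoint w∈ = x≢y⇒x∉⁅y⁆ (x∈∁⁅y⁆⇒x≢y (p─q⊆p _ S w∈))

module _ (G : Graph) where
  open Graph G

  Blocking : Subset m → (Fin m → ℕ) → Subset m → Set
  Blocking X p S = ∀ {u} → u ∈ S → deg G (X ─ S) u < p u

  parking⇒¬blocking : ∀ {X p S} → IsParking G X p → S ⊆ X → sink ∉ S → Nonempty S → ¬ Blocking X p S
  parking⇒¬blocking (_ , parks) S⊆X s∉S nonempty S-blocks with parks _ S⊆X s∉S nonempty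
  ... | u , u∈S , p≤deg = <⇒≱ (S-blocks u∈S) p≤deg

  ¬blocking⇒parking : ∀ {X p} → (∀ u → u ∈ X → u ≢ sink → 1 ≤ p u) →
                      (∀ S → S ⊆ X → sink ∉ S → Nonempty S → ¬ Blocking X p S) → IsParking G X p
  ¬blocking⇒parking {X} {p} positive unblocked = positive , parks
    where
    parks : ∀ S → S ⊆ X → sink ∉ S → Nonempty S → ∃ λ u → u ∈ S × p u ≤ deg G (X ─ S) u
    parks S S⊆X s∉S nonempty with any? (λ u → (u ∈? S) ×-dec (p u ≤? deg G (X ─ S) u))
    ... | yes parked = parked
    ... | no  none   = ⊥-elim (unblocked S S⊆X s∉S nonempty λ {u} u∈S →
                                   ≰⇒> λ p≤deg → none (u , u∈S , p≤deg))

  blocking-∪ : ∀ {X Y Z p S T} → Blocking X p S → Blocking Y p T →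
               Z ─ (S ∪ T) ⊆ X ─ S → Z ─ (S ∪ T) ⊆ Y ─ T → Blocking Z p (S ∪ T)
  blocking-∪ {S = S} {T} S-blocks T-blocks ⊆X─S ⊆Y─T u∈S∪T with x∈p∪q⁻ S T u∈S∪T
  ... | inj₁ u∈S = ≤-<-trans (sumOver-mono ⊆X─S) (S-blocks u∈S)
  ... | inj₂ u∈T = ≤-<-trans (sumOver-mono ⊆Y─T) (T-blocks u∈T)

  shifted-parking : ∀ {p A} → IsGParking G p → A ⊆ Ṽ G → (∀ {u} → u ∈ Ṽ G ─ A → deg G A u < p u) →
                    IsParking G ((Ṽ G ─ A) ∪ ⁅ sink ⁆) (λ u → p u ∸ deg G A u)
  shifted-parking {p} {A} (_ , parks) A⊆Ṽ deg<p = positive , parks′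
    where
    B = (Ṽ G ─ A) ∪ ⁅ sink ⁆
    B-nonsink : ∀ {u} → u ∈ B → u ≢ sink → u ∈ Ṽ G ─ A
    B-nonsink {u} u∈B u≢s with x∈p∪q⁻ (Ṽ G ─ A) ⁅ sink ⁆ u∈B
    ... | inj₁ u∈Ṽ─A = u∈Ṽ─A
    ... | inj₂ u∈⁅s⁆ = ⊥-elim (u≢s (x∈⁅y⁆⇒x≡y sink u∈⁅s⁆))
    positive : ∀ u → u ∈ B → u ≢ sink → 1 ≤ p u ∸ deg G A u
    positive u u∈B u≢s = m<n⇒0<n∸m (deg<p (B-nonsink u∈B u≢s))
    A∩B=∅ : ∀ {w} → w ∈ A → w ∉ B
    A∩B=∅ w∈A w∈B = x∈p─q⇒x∉q (B-nonsink w∈B (x∈∁⁅y⁆⇒x≢y (A⊆Ṽ w∈A))) w∈A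
    parks′ : ∀ T → T ⊆ B → sink ∉ T → Nonempty T →
             ∃ λ u → u ∈ T × p u ∸ deg G A u ≤ deg G (B ─ T) u
    parks′ T T⊆B s∉T nonempty with parks T ⊆⊤ s∉T nonempty
    ... | u , u∈T , p≤deg = u , u∈T , m≤n+o⇒m∸n≤o (p u) (deg G A u) (subst (p u ≤_) split p≤deg)
      where
      cover : ∀ {w} → w ∈ ⊤ ─ T → w ∈ A ⊎ w ∈ B ─ T
      cover {w} w∈ with w ∈? A | w ≟ sink
      ... | yes w∈A | _        = inj₁ w∈A
      ... | no  w∉A | yes refl = inj₂ (x∈p∧x∉q⇒x∈p─q (x∈p∪q⁺ (inj₂ (x∈⁅x⁆ sink))) s∉T)
      ... | no  w∉A | no  w≢s  =
        inj₂ (x∈p∧x∉q⇒x∈p─q (x∈p∪q⁺ (inj₁ (x∈p∧x∉q⇒x∈p─q (x≢y⇒x∈∁⁅y⁆ w≢s) w∉A)))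
                            (x∈p─q⇒x∉q w∈))
      split : deg G (⊤ ─ T) u ≡ deg G A u + deg G (B ─ T) u
      split = sumOver-split cover (λ w∈A → x∈p∧x∉q⇒x∈p─q ∈⊤ (A∩B=∅ w∈A ∘ T⊆B))
                (λ w∈ → x∈p∧x∉q⇒x∈p─q ∈⊤ (x∈p─q⇒x∉q w∈)) (λ w∈A → A∩B=∅ w∈A ∘ p─q⊆p B T)

module _ (G : Graph) (v : Fin (Graph.m G))
         (twin : ∀ w → w ≢ Graph.sink G → w ≢ v → Graph.mult G w (Graph.sink G) ≡ Graph.mult G w v) where
  open Graph G

  W : Subset m
  W = DeleteVertex G v

  deg-swap-sink : ∀ {S u} → sink ∉ S → v ∉ S → u ≢ sink → u ≢ v → deg G (Ṽ G ─ S) u ≡ deg G (W ─ S) u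
  deg-swap-sink {S} {u} s∉S v∉S u≢s u≢v = +-cancelʳ-≡ (mult u v) _ _ (begin
    deg G (Ṽ G ─ S) u + mult u v     ≡⟨ cong (deg G (Ṽ G ─ S) u +_) (twin u u≢s u≢v) ⟨
    deg G (Ṽ G ─ S) u + mult u sink  ≡⟨ sumOver-∁ (mult u) s∉S ⟨
    deg G (∁ S) u                    ≡⟨ sumOver-∁ (mult u) v∉S ⟩
    deg G (W ─ S) u + mult u v       ∎)
    where open ≡-Reasoning

  module _ (p : Fin m → ℕ) (prime : IsPrime G p) where

    maximal-blocking⇒complement-parking : ∀ {S} → sink ∉ S → v ∉ S → Blocking G W p S →
                         (∀ {T} → S ⊂ T → sink ∉ T → v ∉ T → ¬ Blocking G W p T) →
                         IsParking G ((Ṽ G ─ S) ∪ ⁅ sink ⁆) p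
    maximal-blocking⇒complement-parking {S} s∉S v∉S S-blocks maximal =
      ¬blocking⇒parking G (λ u _ → proj₁ (proj₁ prime) u ∈⊤) unblocked
      where
      A∪s = (Ṽ G ─ S) ∪ ⁅ sink ⁆
      A∪s-nonsink : ∀ {w} → w ∈ A∪s → w ≢ sink → w ∉ S
      A∪s-nonsink {w} w∈A∪s w≢s with x∈p∪q⁻ (Ṽ G ─ S) ⁅ sink ⁆ w∈A∪s
      ... | inj₁ w∈Ṽ─S = x∈p─q⇒x∉q w∈Ṽ─S
      ... | inj₂ w∈⁅s⁆ = ⊥-elim (w≢s (x∈⁅y⁆⇒x≡y sink w∈⁅s⁆))
      off-S : ∀ {w} → w ∉ S → w ∈ A∪s
      off-S {w} w∉S with w ≟ sink
      ... | yes refl = x∈p∪q⁺ (inj₂ (x∈⁅x⁆ sink))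
      ... | no  w≢s  = x∈p∪q⁺ (inj₁ (x∈p∧x∉q⇒x∈p─q (x≢y⇒x∈∁⁅y⁆ w≢s) w∉S))
      S∪-blocks : ∀ {T Z} → Blocking G A∪s p T → (∀ {w} → w ∈ Z → w ∉ T → w ∈ W) →
                  Blocking G Z p (S ∪ T)
      S∪-blocks {T} T-blocks stays-in-W = blocking-∪ G S-blocks T-blocks
        (λ w∈ → let w∈Z , w∉S , w∉T = x∈p─[q∪r]⁻ w∈ in x∈p∧x∉q⇒x∈p─q (stays-in-W w∈Z w∉T) w∉S)
        (λ w∈ → let _   , w∉S , w∉T = x∈p─[q∪r]⁻ w∈ in x∈p∧x∉q⇒x∈p─q (off-S w∉S) w∉T)
      unblocked : ∀ T → T ⊆ A∪s → sink ∉ T → Nonempty T → ¬ Blocking G A∪s p T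
      unblocked T T⊆A∪s s∉T (t , t∈T) T-blocks with v ∈? T
      ... | yes v∈T = parking⇒¬blocking G (proj₁ prime) ⊆⊤
                        (x∉p∧x∉q⇒x∉p∪q s∉S s∉T) (t , x∈p∪q⁺ (inj₂ t∈T))
                        (S∪-blocks {Z = ⊤} T-blocks λ _ w∉T → x≢y⇒x∈∁⁅y⁆ λ { refl → w∉T v∈T })
      ... | no  v∉T = maximal S⊂S∪T (x∉p∧x∉q⇒x∉p∪q s∉S s∉T) (x∉p∧x∉q⇒x∉p∪q v∉S v∉T)
                        (S∪-blocks T-blocks λ w∈W _ → w∈W)
        where
        S⊂S∪T : S ⊂ S ∪ T
        S⊂S∪T = p⊆p∪q T , t , x∈p∪q⁺ (inj₂ t∈T) , A∪s-nonsink (T⊆A∪s t∈T) λ { refl → s∉T t∈T }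

    no-blocking : v ≢ sink → ∀ S → sink ∉ S → v ∉ S → Nonempty S → ¬ Blocking G W p S
    no-blocking v≢s = All.wfRec ⊃-wellFounded 0ℓ _ unblocked-if-supersets-are
      where
      unblocked-if-supersets-are :
        ∀ S → (∀ {T} → S ⊂ T → sink ∉ T → v ∉ T → Nonempty T → ¬ Blocking G W p T) →
        sink ∉ S → v ∉ S → Nonempty S → ¬ Blocking G W p S
      unblocked-if-supersets-are S larger-unblocked s∉S v∉S (u , u∈S) S-blocks =
        proj₂ prime A (p─q⊆p (Ṽ G) S) (v , x∈p∧x∉q⇒x∈p─q (x≢y⇒x∈∁⁅y⁆ v≢s) v∉S) (u , u∈Ṽ─A)
          ( maximal-blocking⇒complement-parking s∉S v∉S S-blocks maximal
          , shifted-parking G (proj₁ prime) (p─q⊆p (Ṽ G) S) deg<p )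
        where
        A = Ṽ G ─ S
        nonsink-nonv : ∀ {w} → w ∈ S → w ≢ sink × w ≢ v
        nonsink-nonv w∈S = (λ { refl → s∉S w∈S }) , (λ { refl → v∉S w∈S })
        u∈Ṽ─A : u ∈ Ṽ G ─ A
        u∈Ṽ─A = x∈p∧x∉q⇒x∈p─q (x≢y⇒x∈∁⁅y⁆ (proj₁ (nonsink-nonv u∈S)))
                               (λ u∈A → x∈p─q⇒x∉q u∈A u∈S)
        maximal : ∀ {T} → S ⊂ T → sink ∉ T → v ∉ T → ¬ Blocking G W p T
        maximal S⊂T@(_ , t , t∈T , _) s∉T v∉T = larger-unblocked S⊂T s∉T v∉T (t , t∈T)
        deg<p : ∀ {w} → w ∈ Ṽ G ─ A → deg G A w < p w
        deg<p w∈ = let w∈S = x∈p─[p─q]⇒x∈q w∈ ; w≢s , w≢v = nonsink-nonv w∈S in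
          subst (_< p _) (sym (deg-swap-sink s∉S v∉S w≢s w≢v)) (S-blocks w∈S)

lemma3p1 : (G : Graph) → (v : Fin (Graph.m G)) → v ≢ Graph.sink G →
    (∀ w → w ≢ Graph.sink G → w ≢ v → Graph.mult G w (Graph.sink G) ≡ Graph.mult G w v) →
    (p : Fin (Graph.m G) → ℕ) → IsPrime G p →
    p v ≤ Graph.mult G v (Graph.sink G) →
    IsParking G (DeleteVertex G v) p
lemma3p1 G v v≢s twin p prime _ =
  ¬blocking⇒parking G (λ u _ → proj₁ (proj₁ prime) u ∈⊤) λ S S⊆W s∉S nonempty →
    no-blocking G v twin p prime v≢s S s∉S (λ v∈S → x∈∁⁅y⁆⇒x≢y (S⊆W v∈S) refl) nonempty
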